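{- Let $n\geq 1$ and $m\geq 3$ be integers with $m\leq 2n+2$. Let $G$ be a graph with $|V(G)|\geq 2n+3$ such that $G$ contains no copy of $B_{n}$ and the complement $\bar G$ contains no copy of $C_{m}$. Then $\Delta(G)<2n+2$.
   Context: All graphs are finite and simple. $\Delta(G)$ denotes the maximum degree of $G$ and $\bar G$ the complement of $G$. The book graph $B_n$ is the graph on $n+2$ vertices consisting of an edge $\{u,w\}$ together with $n$ further vertices each adjacent to both $u$ and $w$. $C_m$ is the cycle on $m$ vertices. -}

module Defs where

open import Data.Bool using (Bool; true; false; not; _∧_; _∨_; T)
open import Data.Nat using (ℕ; zero; suc; _+_; _<_; _≡ᵇ_)
open import Data.Fin using (Fin; toℕ)
open import Data.List using (List; length; filter)
open import Data.List.Base using (allFin)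
open import Relation.Binary.PropositionalEquality using (_≡_)
open import Relation.Nullary using (¬_)
open import Function.Definitions using (Injective)
open import Data.Product using (Σ; ∃)
open import Relation.Nullary.Decidable using (does; yes; no)
open import Data.Bool.Properties using (T?)

record Graph (N : ℕ) : Set where
  field
    adj   : Fin N → Fin N → Bool
    sym   : ∀ x y → adj x y ≡ adj y x
    irrefl : ∀ x → adj x x ≡ false
open Graph public

complement : ∀ {N} → Graph N → Graph N
complement {N} G = record
  { adj = λ x y → not (adj G x y) ∧ not (Data.Nat._≡ᵇ_ (toℕ x) (toℕ y))
  ; sym = symP
  ; irrefl = irr }
  where
  open import Data.Nat.Properties using (≡ᵇ⇒≡; ≡⇒≡ᵇ)
  open import Relation.Binary.PropositionalEquality using (cong₂; refl)
  open import Data.Bool.Properties using (∧-zeroʳ)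
  ≡ᵇ-sym : ∀ a b → (a ≡ᵇ b) ≡ (b ≡ᵇ a)
  ≡ᵇ-sym zero zero = refl
  ≡ᵇ-sym zero (suc b) = refl
  ≡ᵇ-sym (suc a) zero = refl
  ≡ᵇ-sym (suc a) (suc b) = ≡ᵇ-sym a b
  symP : ∀ x y → (not (adj G x y) ∧ not (toℕ x ≡ᵇ toℕ y)) ≡ (not (adj G y x) ∧ not (toℕ y ≡ᵇ toℕ x))
  symP x y = cong₂ (λ u v → not u ∧ not v) (sym G x y) (≡ᵇ-sym (toℕ x) (toℕ y))
  ≡ᵇ-refl : ∀ a → (a ≡ᵇ a) ≡ true
  ≡ᵇ-refl zero = refl
  ≡ᵇ-refl (suc a) = ≡ᵇ-refl a
  irr : ∀ x → (not (adj G x x) ∧ not (toℕ x ≡ᵇ toℕ x)) ≡ false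
  irr x rewrite ≡ᵇ-refl (toℕ x) = ∧-zeroʳ (not (adj G x x))

record Copy {k N : ℕ} (H : Graph k) (G : Graph N) : Set where
  field
    f   : Fin k → Fin N
    inj : Injective _≡_ _≡_ f
    hom : ∀ x y → T (adj H x y) → T (adj G (f x) (f y))

Contains : ∀ {k N} → Graph N → Graph k → Set
Contains G H = Copy H G

degree : ∀ {N} → Graph N → Fin N → ℕ
degree {N} G v = length (filter (λ u → T? (adj G v u)) (allFin N))

MaxDegree< : ∀ {N} → Graph N → ℕ → Set
MaxDegree< {N} G d = ∀ v → degree G v < d

private
  -- a ~ b in book: vertex 0 and 1 form the spine edge; every other vertex
  -- is adjacent to both 0 and 1.
  bookAdjℕ : ℕ → ℕ → Bool
  bookAdjℕ zero zero = false
  bookAdjℕ zero (suc _) = true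
  bookAdjℕ (suc zero) zero = true
  bookAdjℕ (suc zero) (suc zero) = false
  bookAdjℕ (suc zero) (suc (suc _)) = true
  bookAdjℕ (suc (suc _)) zero = true
  bookAdjℕ (suc (suc _)) (suc zero) = true
  bookAdjℕ (suc (suc _)) (suc (suc _)) = false

book : (n : ℕ) → Graph (n + 2)
book n = record
  { adj = λ x y → bookAdjℕ (toℕ x) (toℕ y)
  ; sym = λ x y → s (toℕ x) (toℕ y)
  ; irrefl = λ x → i (toℕ x) }
  where
  open import Relation.Binary.PropositionalEquality using (refl)
  s : ∀ a b → bookAdjℕ a b ≡ bookAdjℕ b a
  s zero zero = refl
  s zero (suc zero) = refl
  s zero (suc (suc b)) = refl
  s (suc zero) zero = refl
  s (suc zero) (suc zero) = refl
  s (suc zero) (suc (suc b)) = refl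
  s (suc (suc a)) zero = refl
  s (suc (suc a)) (suc zero) = refl
  s (suc (suc a)) (suc (suc b)) = refl
  i : ∀ a → bookAdjℕ a a ≡ false
  i zero = refl
  i (suc zero) = refl
  i (suc (suc a)) = refl

-- Cycle C_m on Fin m (meaningful for m ≥ 3): i ~ j iff j ≡ i+1 or i ≡ j+1 (mod m),
-- i.e. |i - j| = 1 or {i,j} = {0, m-1}.
cycAdjℕ : ℕ → ℕ → ℕ → Bool
cycAdjℕ m a b = (suc a ≡ᵇ b) ∨ (suc b ≡ᵇ a) ∨ ((a ≡ᵇ 0) ∧ (suc b ≡ᵇ m)) ∨ ((b ≡ᵇ 0) ∧ (suc a ≡ᵇ m))

private
  open import Relation.Binary.PropositionalEquality using (refl; cong₂)
  open import Data.Bool.Properties using (∨-comm; ∨-assoc)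
  ≡ᵇsym : ∀ a b → (a ≡ᵇ b) ≡ (b ≡ᵇ a)
  ≡ᵇsym zero zero = refl
  ≡ᵇsym zero (suc b) = refl
  ≡ᵇsym (suc a) zero = refl
  ≡ᵇsym (suc a) (suc b) = ≡ᵇsym a b
  sucNe : ∀ a → (suc a ≡ᵇ a) ≡ false
  sucNe zero = refl
  sucNe (suc a) = sucNe a
  sym4 : ∀ p q r t → (p ∨ q ∨ r ∨ t) ≡ (q ∨ p ∨ t ∨ r)
  sym4 true true r t = refl
  sym4 true false r t = refl
  sym4 false true r t = refl
  sym4 false false true true = refl
  sym4 false false true false = refl
  sym4 false false false true = refl
  sym4 false false false false = refl
  cycSym : ∀ m a b → cycAdjℕ m a b ≡ cycAdjℕ m b a
  cycSym m a b = sym4 (suc a ≡ᵇ b) (suc b ≡ᵇ a) ((a ≡ᵇ 0) ∧ (suc b ≡ᵇ m)) ((b ≡ᵇ 0) ∧ (suc a ≡ᵇ m))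
  cycIrr : ∀ k a → cycAdjℕ (suc (suc (suc k))) a a ≡ false
  cycIrr k zero = refl
  cycIrr k (suc a) rewrite sucNe (suc a) = refl

cycleG : (k : ℕ) → Graph (suc (suc (suc k)))
cycleG k = record
  { adj = λ x y → cycAdjℕ (suc (suc (suc k))) (toℕ x) (toℕ y)
  ; sym = λ x y → cycSym (suc (suc (suc k))) (toℕ x) (toℕ y)
  ; irrefl = λ x → cycIrr k (toℕ x) }

cycle : (m : ℕ) → 3 Data.Nat.≤ m → Graph m
cycle (suc (suc (suc k))) (Data.Nat.s≤s (Data.Nat.s≤s (Data.Nat.s≤s Data.Nat.z≤n))) = cycleG k

-- Suppose some vertex v has degree at least 2n + 2, and let S be 2n + 2 of its
-- neighbours.  A vertex x ∈ S with n neighbours inside S spans a book B_n with v,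
-- so every vertex has at most t = n - 1 neighbours inside S.  Set S = w ∷ U.  On
-- the 2t + 3 vertices of U the complement has minimum degree above |U| / 2, so by
-- Dirac's argument (Pósa rotations: repeatedly reverse a segment of a cyclic
-- arrangement to increase its number of complement edges) U carries a Hamiltonian
-- cycle of the complement.  At most t heads of its rotations, and at most t of
-- their (m - 2)-th successors, are neighbours of w; as 2t < |U| some rotation
-- avoids both, and closing its first m - 1 vertices through w gives C_m in the
-- complement.
module Submission where

open import Defs hiding (sym)
open import Data.Bool using (Bool; true; false; not; _∧_; T)
open import Data.Bool.Properties using (T-∨; T-∧)
open import Data.Nat using (ℕ; zero; suc; _+_; _*_; _≤_; _<_; z≤n; s≤s; s≤s⁻¹; z<s; _≤?_; _≡ᵇ_)
open import Data.Nat.Properties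
open import Data.Nat.Tactic.RingSolver using (solve-∀)
import Data.Nat.GeneralisedArithmetic as ℕ
open import Data.Fin using (Fin; toℕ)
open import Data.Fin.Properties using (toℕ-injective; toℕ<n)
open import Data.List using (List; []; _∷_; _∷ʳ_; _++_; [_]; length; reverse; take; map; iterate; filterᵇ; allFin)
open import Data.List.Properties
  using (length-take; length-++; length-iterate; unfold-reverse; ++-assoc; ++-identityʳ)
open import Data.List.Membership.Propositional using (_∈_; find)
open import Data.List.Relation.Unary.Any using (Any; here; there)
open import Data.List.Relation.Unary.All as All using (All; []; _∷_)
open import Data.List.Relation.Unary.All.Properties
  using (all-filter) renaming (filter⁺ to All-filter⁺; take⁺ to All-take⁺)
open import Data.List.Relation.Unary.AllPairs using (_∷_)
open import Data.List.Relation.Unary.Unique.Propositional using (Unique)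
open import Data.List.Relation.Unary.Unique.Propositional.Properties
  using (allFin⁺) renaming (take⁺ to Unique-take⁺; filter⁺ to Unique-filter⁺)
open import Data.List.Relation.Binary.Permutation.Propositional using (_↭_; ↭-refl; ↭-sym; ↭-trans; prep; ↭⇒↭ₛ)
open import Data.List.Relation.Binary.Permutation.Propositional.Properties
  using (↭-length; ∈-resp-↭; filter-↭; ++⁺ˡ; ++-comm; ↭-reverse; ∷↭∷ʳ)
import Data.List.Relation.Binary.Permutation.Setoid.Properties as Permutationₛ
open import Data.Product as Product using (Σ; _×_; _,_; proj₁; proj₂)
open import Data.Sum as Sum using (_⊎_; inj₁; inj₂)
open import Data.Empty using (⊥-elim)
open import Data.Unit using (⊤; tt)
open import Function using (_∘_; Equivalence)
open import Function.Definitions using (Injective)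
open import Relation.Binary.PropositionalEquality hiding ([_])
open import Relation.Nullary using (¬_; yes; no)
open import Relation.Nullary.Decidable using (T?)

private variable
  A B : Set

fromBool : Bool → ℕ
fromBool true = 1
fromBool false = 0

fromBool≤1 : ∀ b → fromBool b ≤ 1
fromBool≤1 true = ≤-refl
fromBool≤1 false = z≤n

count : (A → Bool) → List A → ℕ
count p xs = length (filterᵇ p xs)

count-↭ : (p : A → Bool) {xs ys : List A} → xs ↭ ys → count p xs ≡ count p ys
count-↭ p π = ↭-length (filter-↭ (T? ∘ p) π)

count-∷ : (p : A → Bool) (x : A) (xs : List A) → count p xs ≤ count p (x ∷ xs)
count-∷ p x xs with p x
... | true = n≤1+n _
... | false = ≤-refl

count-map : (p : B → Bool) (f : A → B) (xs : List A) → count p (map f xs) ≡ count (p ∘ f) xs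
count-map p f [] = refl
count-map p f (x ∷ xs) with p (f x)
... | true = cong suc (count-map p f xs)
... | false = count-map p f xs

pigeonhole : (p q : A → Bool) (xs : List A) → count p xs + count q xs < length xs →
  Any (λ x → p x ≡ false × q x ≡ false) xs
pigeonhole p q (x ∷ xs) lt with p x in px
... | true = there (pigeonhole p q xs (≤-trans (s≤s (+-monoʳ-≤ (count p xs) (count-∷ q x xs))) (s≤s⁻¹ lt)))
... | false with q x in qx
...   | false = here (px , qx)
...   | true = there (pigeonhole p q xs (≤-trans (≤-reflexive (sym (+-suc _ _))) (s≤s⁻¹ lt)))

Unique-resp-↭ : {xs ys : List A} → xs ↭ ys → Unique xs → Unique ys
Unique-resp-↭ π = Permutationₛ.Unique-resp-↭ (setoid _) (↭⇒↭ₛ π)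

-- d is the value at out-of-range indices.
nth : A → List A → ℕ → A
nth d [] i = d
nth d (x ∷ xs) zero = x
nth d (x ∷ xs) (suc i) = nth d xs i

nth-∈ : (d : A) (xs : List A) {i : ℕ} → i < length xs → nth d xs i ∈ xs
nth-∈ d (x ∷ xs) {zero} _ = here refl
nth-∈ d (x ∷ xs) {suc i} i<n = there (nth-∈ d xs (s≤s⁻¹ i<n))

nth-injective : (d : A) (xs : List A) → Unique xs → ∀ {i j} → i < length xs → j < length xs →
  nth d xs i ≡ nth d xs j → i ≡ j
nth-injective d (x ∷ xs) u {zero} {zero} _ _ _ = refl
nth-injective d (x ∷ xs) (x∉ ∷ u) {zero} {suc j} _ j<n e =
  ⊥-elim (All.lookup x∉ (nth-∈ d xs (s≤s⁻¹ j<n)) e)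
nth-injective d (x ∷ xs) (x∉ ∷ u) {suc i} {zero} i<n _ e =
  ⊥-elim (All.lookup x∉ (nth-∈ d xs (s≤s⁻¹ i<n)) (sym e))
nth-injective d (x ∷ xs) (_ ∷ u) {suc i} {suc j} i<n j<n e =
  cong suc (nth-injective d xs u (s≤s⁻¹ i<n) (s≤s⁻¹ j<n) e)

-- A list x ∷ xs is read as a cyclic arrangement, closed by the pair (last x xs, x).
-- Ē is adjacency in the complement of E, except that it does not exclude loops.
module Arrangements {V : Set} (E : V → V → Bool) (E-sym : ∀ x y → E x y ≡ E y x) where

  Ē : V → V → Bool
  Ē x y = not (E x y)

  Ē-sym : ∀ x y → Ē x y ≡ Ē y x
  Ē-sym x y = cong not (E-sym x y)

  last : V → List V → V
  last x [] = x
  last x (y ∷ ys) = last y ys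

  last-∈ : ∀ x xs → last x xs ∈ x ∷ xs
  last-∈ x [] = here refl
  last-∈ x (y ∷ ys) = there (last-∈ y ys)

  last-++ : ∀ x xs y ys → last x (xs ++ y ∷ ys) ≡ last y ys
  last-++ x [] y ys = refl
  last-++ x (z ∷ zs) y ys = last-++ z zs y ys

  nth-length≡last : ∀ d x xs → nth d (x ∷ xs) (length xs) ≡ last x xs
  nth-length≡last d x [] = refl
  nth-length≡last d x (y ∷ ys) = nth-length≡last d y ys

  Chain : V → List V → Set
  Chain x [] = ⊤
  Chain x (y ∷ ys) = Ē x y ≡ true × Chain y ys

  Chain-snoc : ∀ x xs z → Chain x xs → Ē (last x xs) z ≡ true → Chain x (xs ++ [ z ])
  Chain-snoc x [] z _ ē = ē , tt
  Chain-snoc x (y ∷ ys) z (ē₁ , ch) ē = ē₁ , Chain-snoc y ys z ch ē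

  Chain-take : ∀ k x xs → Chain x xs → Chain x (take k xs)
  Chain-take zero x xs ch = tt
  Chain-take (suc k) x [] ch = tt
  Chain-take (suc k) x (y ∷ ys) (ē , ch) = ē , Chain-take k y ys ch

  Chain-nth : ∀ d x xs {i} → Chain x xs → suc i < length (x ∷ xs) →
    Ē (nth d (x ∷ xs) i) (nth d (x ∷ xs) (suc i)) ≡ true
  Chain-nth d x [] _ (s≤s ())
  Chain-nth d x (y ∷ ys) {zero} (ē , _) _ = ē
  Chain-nth d x (y ∷ ys) {suc i} (_ , ch) i<n = Chain-nth d y ys ch (s≤s⁻¹ i<n)

  Closed : V → List V → Set
  Closed x xs = Chain x xs × Ē (last x xs) x ≡ true

  links : V → List V → ℕ
  links x [] = 0
  links x (y ∷ ys) = fromBool (Ē x y) + links y ys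

  links-++ : ∀ x xs y ys → links x (xs ++ y ∷ ys) ≡ links x xs + (fromBool (Ē (last x xs) y) + links y ys)
  links-++ x [] y ys = refl
  links-++ x (z ∷ zs) y ys rewrite links-++ z zs y ys = sym (+-assoc (fromBool (Ē x z)) _ _)

  links≤length : ∀ x xs → links x xs ≤ length xs
  links≤length x [] = z≤n
  links≤length x (y ∷ ys) with Ē x y
  ... | true = s≤s (links≤length y ys)
  ... | false = m≤n⇒m≤1+n (links≤length y ys)

  length≤links⇒Chain : ∀ x xs → length xs ≤ links x xs → Chain x xs
  length≤links⇒Chain x [] _ = tt
  length≤links⇒Chain x (y ∷ ys) len≤ with Ē x y
  ... | true = refl , length≤links⇒Chain y ys (s≤s⁻¹ len≤)
  ... | false = ⊥-elim (<⇒≱ (s≤s (links≤length y ys)) len≤)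

  links-reverse : ∀ b bs → Σ (List V) λ rs → reverse (b ∷ bs) ≡ last b bs ∷ rs ×
    last (last b bs) rs ≡ b × links (last b bs) rs ≡ links b bs
  links-reverse b [] = [] , refl , refl , refl
  links-reverse b (c ∷ cs) with links-reverse c cs
  ... | rs , rev , last-rs , links-rs = rs ++ [ b ] , rev′ , last-++ y rs b [] , links′
    where
    open ≡-Reasoning
    y = last c cs
    rev′ : reverse (b ∷ c ∷ cs) ≡ y ∷ (rs ++ [ b ])
    rev′ = trans (unfold-reverse b (c ∷ cs)) (cong (_∷ʳ b) rev)
    links′ : links y (rs ++ [ b ]) ≡ fromBool (Ē b c) + links c cs
    links′ = begin
      links y (rs ++ [ b ])                          ≡⟨ links-++ y rs b [] ⟩
      links y rs + (fromBool (Ē (last y rs) b) + 0)  ≡⟨ cong₂ (λ l z → l + (fromBool (Ē z b) + 0))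
                                                                links-rs last-rs ⟩
      links c cs + (fromBool (Ē c b) + 0)            ≡⟨ cong (links c cs +_) (+-identityʳ _) ⟩
      links c cs + fromBool (Ē c b)                  ≡⟨ +-comm (links c cs) _ ⟩
      fromBool (Ē c b) + links c cs                  ≡⟨ cong (λ z → fromBool z + links c cs) (Ē-sym c b) ⟩
      fromBool (Ē b c) + links c cs                  ∎

  cyclicLinks : V → List V → ℕ
  cyclicLinks x xs = links x xs + fromBool (Ē (last x xs) x)

  cyclicLinks-++ : ∀ x as b bs → cyclicLinks x (as ++ b ∷ bs) ≡
    links x as + (fromBool (Ē (last x as) b) + links b bs) + fromBool (Ē (last b bs) x)
  cyclicLinks-++ x as b bs =
    cong₂ _+_ (links-++ x as b bs) (cong (λ z → fromBool (Ē z x)) (last-++ x as b bs))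

  cyclicLinks-rotate : ∀ x as b bs → cyclicLinks x (as ++ b ∷ bs) ≡ cyclicLinks b (bs ++ x ∷ as)
  cyclicLinks-rotate x as b bs =
    trans (cyclicLinks-++ x as b bs) (trans (regroup (links x as) _ (links b bs) _) (sym (cyclicLinks-++ b bs x as)))
    where
    regroup : ∀ p q r s → p + (q + r) + s ≡ r + (s + p) + q
    regroup = solve-∀

  length≤cyclicLinks⇒Closed : ∀ x xs → length (x ∷ xs) ≤ cyclicLinks x xs → Closed x xs
  length≤cyclicLinks⇒Closed x xs len≤ with Ē (last x xs) x
  ... | true = length≤links⇒Chain x xs (s≤s⁻¹ (subst (length (x ∷ xs) ≤_) (+-comm _ 1) len≤)) , refl
  ... | false = ⊥-elim (<⇒≱ (s≤s (links≤length x xs)) (subst (length (x ∷ xs) ≤_) (+-identityʳ _) len≤))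

  module Dirac (t : ℕ) (U : List V) (sparse : ∀ x → x ∈ U → count (E x) U ≤ t)
               (long : suc (t + t) < length U) where

    tail-long : ∀ {x xs} → x ∷ xs ↭ U → t + t < length xs
    tail-long π = s≤s⁻¹ (subst (suc (t + t) <_) (sym (↭-length π)) long)

    sparse-↭ : ∀ {L} z → L ↭ U → z ∈ L → count (E z) L ≤ t
    sparse-↭ z π z∈L = subst (_≤ t) (sym (count-↭ (E z) π)) (sparse z (∈-resp-↭ π z∈L))

    Improvement : V → List V → Set
    Improvement x xs = Σ V λ x′ → Σ (List V) λ xs′ → x′ ∷ xs′ ↭ U × cyclicLinks x xs < cyclicLinks x′ xs′

    -- A place to cut r = as ++ b ∷ bs such that reversing b ∷ bs in x ∷ r creates the
    -- complement edges (last a as, y) and (b, x).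
    Crossing : V → V → V → List V → Set
    Crossing x y a r = Σ (List V) λ as → Σ V λ b → Σ (List V) λ bs →
      r ≡ as ++ b ∷ bs × Ē y (last a as) ≡ true × Ē x b ≡ true

    Crossing-∷ : ∀ {x y a b r} → Crossing x y b r → Crossing x y a (b ∷ r)
    Crossing-∷ {b = b} (as , b′ , bs , eq , ē₁ , ē₂) = b ∷ as , b′ , bs , cong (b ∷_) eq , ē₁ , ē₂

    crossing : ∀ x y a r → Crossing x y a r ⊎ length r ≤ count (E y) (a ∷ r) + count (E x) r
    crossing x y a [] = inj₂ z≤n
    crossing x y a (b ∷ r) with E y a in ya
    ... | true = Sum.map Crossing-∷ (λ le → s≤s (≤-trans le (+-monoʳ-≤ _ (count-∷ (E x) b r)))) (crossing x y b r)
    ... | false with E x b in xb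
    ...   | false = inj₁ ([] , b , r , refl , cong not ya , cong not xb)
    ...   | true = Sum.map Crossing-∷ (λ le → ≤-trans (s≤s le) (≤-reflexive (sym (+-suc _ _)))) (crossing x y b r)

    -- The closing pair is no complement edge: a crossing exists since x and y have at
    -- most 2t neighbours together, and reversing at it gains a link.
    improve-closing : ∀ x xs → x ∷ xs ↭ U → Ē (last x xs) x ≡ false → Improvement x xs
    improve-closing x xs π open′ with crossing x (last x xs) x xs
    ... | inj₂ le = ⊥-elim (<⇒≱ (tail-long π) (≤-trans le (+-mono-≤ sparse-y sparse-x)))
      where
      sparse-y : count (E (last x xs)) (x ∷ xs) ≤ t
      sparse-y = sparse-↭ (last x xs) π (last-∈ x xs)
      sparse-x : count (E x) xs ≤ t
      sparse-x = ≤-trans (count-∷ (E x) x xs) (sparse-↭ x π (here refl))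
    ... | inj₁ (as , b , bs , refl , ē₁ , ē₂) with links-reverse b bs
    ... | rs , rev , last-rs , links-rs = x , as ++ y ∷ rs , π′ , gain
      where
      open ≤-Reasoning
      y = last b bs
      a = last x as
      π′ : x ∷ as ++ y ∷ rs ↭ U
      π′ = ↭-trans (subst (λ z → x ∷ as ++ z ↭ x ∷ as ++ b ∷ bs) rev
                      (prep x (++⁺ˡ as (↭-reverse (b ∷ bs))))) π
      ay : Ē a y ≡ true
      ay = trans (Ē-sym a y) (subst (λ z → Ē z a ≡ true) (last-++ x as b bs) ē₁)
      bx : Ē b x ≡ true
      bx = trans (Ē-sym b x) ē₂
      before : cyclicLinks x (as ++ b ∷ bs) ≡ links x as + (fromBool (Ē a b) + links b bs) + 0
      before = cong₂ _+_ (links-++ x as b bs) (cong fromBool open′)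
      after : cyclicLinks x (as ++ y ∷ rs) ≡ links x as + (1 + links b bs) + 1
      after = cong₂ _+_ (trans (links-++ x as y rs) (cong₂ (λ e l → links x as + (fromBool e + l)) ay links-rs))
                        (cong fromBool (trans (cong (λ z → Ē z x) (trans (last-++ x as y rs) last-rs)) bx))
      gain : cyclicLinks x (as ++ b ∷ bs) < cyclicLinks x (as ++ y ∷ rs)
      gain = begin-strict
        cyclicLinks x (as ++ b ∷ bs)                       ≡⟨ before ⟩
        links x as + (fromBool (Ē a b) + links b bs) + 0   ≡⟨ +-identityʳ _ ⟩
        links x as + (fromBool (Ē a b) + links b bs)       ≤⟨ +-monoʳ-≤ (links x as)
                                                                (+-monoˡ-≤ (links b bs) (fromBool≤1 (Ē a b))) ⟩
        links x as + (1 + links b bs)                      <⟨ m<m+n _ z<s ⟩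
        links x as + (1 + links b bs) + 1                  ≡⟨ sym after ⟩
        cyclicLinks x (as ++ y ∷ rs)                       ∎

    Gap : V → List V → Set
    Gap x xs = Σ (List V) λ as → Σ V λ b → Σ (List V) λ bs → xs ≡ as ++ b ∷ bs × Ē (last x as) b ≡ false

    gap : ∀ x xs → links x xs < length xs → Gap x xs
    gap x (y ∷ ys) lt with Ē x y in xy
    ... | false = [] , y , ys , refl , xy
    ... | true with gap y ys (s≤s⁻¹ lt)
    ...   | as , b , bs , eq , ē = y ∷ as , b , bs , cong (y ∷_) eq , ē

    -- An inner gap becomes the closing pair after rotating the arrangement.
    improve-gap : ∀ x as b bs → x ∷ as ++ b ∷ bs ↭ U → Ē (last x as) b ≡ false → Improvement x (as ++ b ∷ bs)
    improve-gap x as b bs π ē with improve-closing b (bs ++ x ∷ as) π′ open′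
      where
      π′ : b ∷ bs ++ x ∷ as ↭ U
      π′ = ↭-trans (++-comm (b ∷ bs) (x ∷ as)) π
      open′ : Ē (last b (bs ++ x ∷ as)) b ≡ false
      open′ = subst (λ z → Ē z b ≡ false) (sym (last-++ b bs x as)) ē
    ... | x′ , xs′ , π″ , gain =
      x′ , xs′ , π″ , subst (_< cyclicLinks x′ xs′) (sym (cyclicLinks-rotate x as b bs)) gain

    improve : ∀ x xs → x ∷ xs ↭ U → cyclicLinks x xs < length (x ∷ xs) → Improvement x xs
    improve x xs π lt = by-closing-pair (Ē (last x xs) x) refl
      where
      by-closing-pair : ∀ c → Ē (last x xs) x ≡ c → Improvement x xs
      by-closing-pair false open′ = improve-closing x xs π open′
      by-closing-pair true closed with gap x xs links<length
        where
        links<length : links x xs < length xs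
        links<length = s≤s⁻¹ (subst (_< length (x ∷ xs)) (+-comm _ 1)
                                (subst (λ c → links x xs + fromBool c < length (x ∷ xs)) closed lt))
      ... | as , b , bs , refl , ē = improve-gap x as b bs π ē

    IsHamiltonian : V × List V → Set
    IsHamiltonian (x , xs) = x ∷ xs ↭ U × Closed x xs

    HamiltonianCycle : Set
    HamiltonianCycle = Σ (V × List V) IsHamiltonian

    hamiltonian-from : ∀ fuel x xs → x ∷ xs ↭ U → length (x ∷ xs) ≤ cyclicLinks x xs + fuel → HamiltonianCycle
    hamiltonian-from fuel x xs π enough with length (x ∷ xs) ≤? cyclicLinks x xs
    ... | yes full = (x , xs) , π , length≤cyclicLinks⇒Closed x xs full
    ... | no short with fuel | improve x xs π (≰⇒> short)
    ...   | zero | _ = ⊥-elim (short (subst (length (x ∷ xs) ≤_) (+-identityʳ _) enough))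
    ...   | suc fuel′ | x′ , xs′ , π′ , gain = hamiltonian-from fuel′ x′ xs′ π′ enough′
      where
      open ≤-Reasoning
      enough′ : length (x′ ∷ xs′) ≤ cyclicLinks x′ xs′ + fuel′
      enough′ = begin
        length (x′ ∷ xs′)              ≡⟨ trans (↭-length π′) (sym (↭-length π)) ⟩
        length (x ∷ xs)                ≤⟨ enough ⟩
        cyclicLinks x xs + suc fuel′   ≡⟨ +-suc _ fuel′ ⟩
        suc (cyclicLinks x xs) + fuel′ ≤⟨ +-monoˡ-≤ fuel′ gain ⟩
        cyclicLinks x′ xs′ + fuel′     ∎

    hamiltonian : HamiltonianCycle
    hamiltonian = start U ↭-refl long
      where
      start : ∀ L → L ↭ U → suc (t + t) < length L → HamiltonianCycle
      start (x ∷ xs) π _ = hamiltonian-from (length (x ∷ xs)) x xs π (m≤n+m _ _)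

    toList : V × List V → List V
    toList (x , xs) = x ∷ xs

    rotate : V × List V → V × List V
    rotate (x , []) = x , []
    rotate (x , y ∷ ys) = y , ys ++ [ x ]

    rotate-↭ : ∀ c → toList (rotate c) ↭ toList c
    rotate-↭ (x , []) = ↭-refl
    rotate-↭ (x , y ∷ ys) = ↭-sym (∷↭∷ʳ x (y ∷ ys))

    rotate-IsHamiltonian : ∀ c → IsHamiltonian c → IsHamiltonian (rotate c)
    rotate-IsHamiltonian (x , []) h = h
    rotate-IsHamiltonian (x , y ∷ ys) (π , (xy , ch) , closing) =
      ↭-trans (rotate-↭ (x , y ∷ ys)) π ,
      Chain-snoc y ys x ch closing ,
      subst (λ z → Ē z y ≡ true) (sym (last-++ y ys x [])) xy

    rotateⁿ : ℕ → V × List V → V × List V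
    rotateⁿ s c = ℕ.iterate rotate c s

    rotateⁿ-↭ : ∀ s c → toList (rotateⁿ s c) ↭ toList c
    rotateⁿ-↭ zero c = ↭-refl
    rotateⁿ-↭ (suc s) c = ↭-trans (rotateⁿ-↭ s (rotate c)) (rotate-↭ c)

    rotateⁿ-rotate : ∀ s c → rotateⁿ s (rotate c) ≡ rotate (rotateⁿ s c)
    rotateⁿ-rotate zero c = refl
    rotateⁿ-rotate (suc s) c = rotateⁿ-rotate s (rotate c)

    rotateⁿ-head : ∀ s a as → s ≤ length as → proj₁ (rotateⁿ s (a , as)) ≡ last a (take s as)
    rotateⁿ-head zero a as _ = refl
    rotateⁿ-head (suc s) a (b ∷ bs) (s≤s s≤n) = trans
      (rotateⁿ-head s b (bs ++ [ a ]) (≤-trans s≤n (≤-trans (m≤m+n _ 1) (≤-reflexive (sym (length-++ bs))))))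
      (cong (last b) (take-++ s bs s≤n))
      where
      take-++ : ∀ k xs → k ≤ length xs → take k (xs ++ [ a ]) ≡ take k xs
      take-++ zero xs _ = refl
      take-++ (suc k) (x ∷ xs) (s≤s k≤n) = cong (x ∷_) (take-++ k xs k≤n)

    rotations : ℕ → V × List V → List (V × List V)
    rotations n c = iterate rotate c n

    rotations-IsHamiltonian : ∀ n c → IsHamiltonian c → All IsHamiltonian (rotations n c)
    rotations-IsHamiltonian zero c h = []
    rotations-IsHamiltonian (suc n) c h = h ∷ rotations-IsHamiltonian n (rotate c) (rotate-IsHamiltonian c h)

    heads-rotations : ∀ {n} c → length (toList c) ≡ n → map proj₁ (rotations n c) ≡ toList c
    heads-rotations (x , xs) refl = subst (λ z → map proj₁ (rotations (length (x ∷ xs)) (x , z)) ≡ x ∷ xs)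
                                      (++-identityʳ xs) (heads x xs [])
      where
      heads : ∀ a as zs → map proj₁ (rotations (length (a ∷ as)) (a , as ++ zs)) ≡ a ∷ as
      heads a [] zs = refl
      heads a (b ∷ bs) zs rewrite ++-assoc bs zs [ a ] = cong (a ∷_) (heads b bs (zs ++ [ a ]))

    heads-rotations-rotateⁿ : ∀ s n c →
      map (proj₁ ∘ rotateⁿ s) (rotations n c) ≡ map proj₁ (rotations n (rotateⁿ s c))
    heads-rotations-rotateⁿ s zero c = refl
    heads-rotations-rotateⁿ s (suc n) c = cong (proj₁ (rotateⁿ s c) ∷_)
      (trans (heads-rotations-rotateⁿ s n (rotate c)) (cong (map proj₁ ∘ rotations n) (rotateⁿ-rotate s c)))

    avoidingRotation : (w : V) → count (E w) U ≤ t → (s : ℕ) → HamiltonianCycle →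
      Σ (V × List V) λ c → IsHamiltonian c × Ē w (proj₁ c) ≡ true × Ē w (proj₁ (rotateⁿ s c)) ≡ true
    avoidingRotation w sparse-w s (c₀ , h@(π , _))
      with find (pigeonhole (E w ∘ proj₁) (E w ∘ proj₁ ∘ rotateⁿ s) R few)
      where
      R = rotations (length U) c₀
      sparse-heads : ∀ c → toList c ↭ U → count (E w) (map proj₁ (rotations (length U) c)) ≤ t
      sparse-heads c π′ = begin
        count (E w) (map proj₁ (rotations (length U) c))  ≡⟨ cong (count (E w)) (heads-rotations c (↭-length π′)) ⟩
        count (E w) (toList c)                             ≡⟨ count-↭ (E w) π′ ⟩
        count (E w) U                                      ≤⟨ sparse-w ⟩
        t                                                  ∎
        where open ≤-Reasoning
      few-heads : count (E w ∘ proj₁) R ≤ t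
      few-heads = subst (_≤ t) (count-map (E w) proj₁ R) (sparse-heads c₀ π)
      few-successors : count (E w ∘ proj₁ ∘ rotateⁿ s) R ≤ t
      few-successors = subst (_≤ t)
        (trans (cong (count (E w)) (sym (heads-rotations-rotateⁿ s (length U) c₀)))
               (count-map (E w) (proj₁ ∘ rotateⁿ s) R))
        (sparse-heads (rotateⁿ s c₀) (↭-trans (rotateⁿ-↭ s c₀) π))
      few : count (E w ∘ proj₁) R + count (E w ∘ proj₁ ∘ rotateⁿ s) R < length R
      few = ≤-<-trans (+-mono-≤ few-heads few-successors)
                      (subst (t + t <_) (sym (length-iterate rotate c₀ (length U))) (<⇒≤ long))
    ... | c , c∈R , head-free , successor-free =
      c , All.lookup (rotations-IsHamiltonian _ c₀ h) c∈R , cong not head-free , cong not successor-free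

    cycleThrough : (w : V) → count (E w) U ≤ t → (s : ℕ) → s < length U →
      Σ V λ a → Σ (List V) λ as → a ∷ as ↭ U × Closed w (a ∷ take s as)
    cycleThrough w sparse-w s s<n with avoidingRotation w sparse-w s hamiltonian
    ... | (a , as) , (π , ch , _) , wa , was = a , as , π , (wa , Chain-take s a as ch) , closing
      where
      s≤n : s ≤ length as
      s≤n = s≤s⁻¹ (subst (s <_) (sym (↭-length π)) s<n)
      closing : Ē (last a (take s as)) w ≡ true
      closing = trans (Ē-sym _ w) (subst (λ z → Ē w z ≡ true) (rotateⁿ-head s a as s≤n) was)

adj⇒≢ : ∀ {N} (G : Graph N) {x y} → T (adj G x y) → x ≢ y
adj⇒≢ G {x} xy refl = subst T (irrefl G x) xy

adj-sym : ∀ {N} (G : Graph N) {x y} → T (adj G x y) → T (adj G y x)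
adj-sym G {x} {y} = subst T (Graph.sym G x y)

embed : ∀ {k} → A → List A → Fin k → A
embed d C i = nth d C (toℕ i)

listCopy : ∀ {k N} (H : Graph k) (G : Graph N) (d : Fin N) (C : List (Fin N)) → Unique C → k ≤ length C →
  (∀ i j → T (adj H i j) → embed d C i ≢ embed d C j → T (adj G (embed d C i) (embed d C j))) →
  Copy H G
listCopy H G d C unique k≤n hom = record
  { f = embed d C ; inj = inj ; hom = λ i j h → hom i j h (adj⇒≢ H h ∘ inj) }
  where
  inj : Injective _≡_ _≡_ (embed d C)
  inj {i} {j} = toℕ-injective ∘ nth-injective d C unique (<-≤-trans (toℕ<n i) k≤n) (<-≤-trans (toℕ<n j) k≤n)

CycleStep : ℕ → ℕ → ℕ → Set
CycleStep M a b = b ≡ suc a ⊎ (a ≡ 0 × suc b ≡ M)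

T-≡ᵇ-∧ : ∀ m n m′ n′ → T ((m ≡ᵇ n) ∧ (m′ ≡ᵇ n′)) → m ≡ n × m′ ≡ n′
T-≡ᵇ-∧ m n m′ n′ = Product.map (≡ᵇ⇒≡ m n) (≡ᵇ⇒≡ m′ n′) ∘ Equivalence.to T-∧

cycAdj⇒CycleStep : ∀ M a b → T (cycAdjℕ M a b) → CycleStep M a b ⊎ CycleStep M b a
cycAdj⇒CycleStep M a b h with Equivalence.to T-∨ h
... | inj₁ forward = inj₁ (inj₁ (sym (≡ᵇ⇒≡ (suc a) b forward)))
... | inj₂ h′ with Equivalence.to T-∨ h′
...   | inj₁ backward = inj₂ (inj₁ (sym (≡ᵇ⇒≡ (suc b) a backward)))
...   | inj₂ h″ with Equivalence.to T-∨ h″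
...     | inj₁ wrap = inj₁ (inj₂ (T-≡ᵇ-∧ a 0 (suc b) M wrap))
...     | inj₂ wrap = inj₂ (inj₂ (T-≡ᵇ-∧ b 0 (suc a) M wrap))

module _ {N : ℕ} (G : Graph N) where
  open Arrangements (adj G) (Graph.sym G)

  Ē⇒complement : ∀ {x y} → Ē x y ≡ true → x ≢ y → T (adj (complement G) x y)
  Ē⇒complement {x} {y} ē x≢y with adj G x y | toℕ x ≡ᵇ toℕ y in same
  ... | false | false = tt
  ... | false | true = ⊥-elim (x≢y (toℕ-injective (≡ᵇ⇒≡ (toℕ x) (toℕ y) (subst T (sym same) tt))))
  Ē⇒complement () x≢y | true | _

  cycleCopy : ∀ k c cs → length (c ∷ cs) ≡ suc (suc (suc k)) → Unique (c ∷ cs) → Closed c cs →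
    Copy (cycleG k) (complement G)
  cycleCopy k c cs len unique (chain , closing) =
    listCopy (cycleG k) (complement G) c C unique (≤-reflexive (sym len)) λ i j h i≢j →
      Ē⇒complement (edge (toℕ i) (toℕ j) (bound i) (bound j) (cycAdj⇒CycleStep M (toℕ i) (toℕ j) h)) i≢j
    where
    M = suc (suc (suc k))
    C = c ∷ cs
    bound : (i : Fin M) → toℕ i < length C
    bound i = subst (toℕ i <_) (sym len) (toℕ<n i)
    step : ∀ a b → b < length C → CycleStep M a b → Ē (nth c C a) (nth c C b) ≡ true
    step a .(suc a) b<n (inj₁ refl) = Chain-nth c c cs chain b<n
    step .0 b _ (inj₂ (refl , 1+b≡M)) = begin
      Ē c (nth c C b)  ≡⟨ cong (Ē c) (trans (cong (nth c C) b≡) (nth-length≡last c c cs)) ⟩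
      Ē c (last c cs)  ≡⟨ Ē-sym c _ ⟩
      Ē (last c cs) c  ≡⟨ closing ⟩
      true             ∎
      where
      open ≡-Reasoning
      b≡ : b ≡ length cs
      b≡ = suc-injective (trans 1+b≡M (sym len))
    edge : ∀ a b → a < length C → b < length C → CycleStep M a b ⊎ CycleStep M b a →
      Ē (nth c C a) (nth c C b) ≡ true
    edge a b _ b<n (inj₁ a→b) = step a b b<n a→b
    edge a b a<n _ (inj₂ b→a) = trans (Ē-sym _ _) (step b a a<n b→a)

  -- The book on the spine v x whose pages are the common neighbours of v and x in S.
  bookCopy : ∀ n (v x : Fin N) (S : List (Fin N)) → Unique S → All (λ y → T (adj G v y)) S → x ∈ S →
    n ≤ count (adj G x) S → Copy (book n) G
  bookCopy n v x S unique-S nbrs x∈S n≤ =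
    listCopy (book n) G v L unique-L (≤-trans (≤-reflexive (+-comm n 2)) (s≤s (s≤s n≤))) hom
    where
    C = filterᵇ (adj G x) S
    L = v ∷ x ∷ C
    vC : All (λ y → T (adj G v y)) C
    vC = All-filter⁺ (T? ∘ adj G x) nbrs
    xC : All (λ y → T (adj G x y)) C
    xC = all-filter (T? ∘ adj G x) S
    vx : T (adj G v x)
    vx = All.lookup nbrs x∈S
    unique-L : Unique L
    unique-L = (adj⇒≢ G vx ∷ All.map (adj⇒≢ G) vC) ∷ All.map (adj⇒≢ G) xC
             ∷ Unique-filter⁺ (T? ∘ adj G x) unique-S
    page : ∀ {P : Fin N → Set} → All P C → ∀ b → suc (suc b) < length L → P (nth v L (suc (suc b)))
    page all b b<n = All.lookup all (nth-∈ v C (s≤s⁻¹ (s≤s⁻¹ b<n)))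
    bound : (i : Fin (n + 2)) → toℕ i < length L
    bound i = <-≤-trans (toℕ<n i) (≤-trans (≤-reflexive (+-comm n 2)) (s≤s (s≤s n≤)))
    hom : ∀ i j → T (adj (book n) i j) → embed v L i ≢ embed v L j → T (adj G (embed v L i) (embed v L j))
    hom i j h _ with toℕ i | toℕ j | bound i | bound j
    hom i j () _ | zero | zero | _ | _
    ... | zero | suc zero | _ | _ = vx
    ... | zero | suc (suc b) | _ | b<n = page vC b b<n
    ... | suc zero | zero | _ | _ = adj-sym G vx
    hom i j () _ | suc zero | suc zero | _ | _
    ... | suc zero | suc (suc b) | _ | b<n = page xC b b<n
    ... | suc (suc a) | zero | a<n | _ = adj-sym G (page vC a a<n)
    ... | suc (suc a) | suc zero | a<n | _ = adj-sym G (page xC a a<n)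
    hom i j () _ | suc (suc a) | suc (suc b) | _ | _

  bookFree⇒sparse : ∀ t (v : Fin N) (S : List (Fin N)) → ¬ Contains G (book (suc t)) → Unique S →
    All (λ y → T (adj G v y)) S → ∀ x → x ∈ S → count (adj G x) S ≤ t
  bookFree⇒sparse t v S noBook unique nbrs x x∈S = ≮⇒≥ (noBook ∘ bookCopy (suc t) v x S unique nbrs x∈S)

  neighbourhoodCycle : ∀ t k (v w : Fin N) (U : List (Fin N)) → ¬ Contains G (book (suc t)) →
    Unique (w ∷ U) → All (λ y → T (adj G v y)) (w ∷ U) → length U ≡ 3 + (t + t) → k ≤ suc (t + t) →
    Copy (cycleG k) (complement G)
  neighbourhoodCycle t k v w U noBook unique nbrs len k≤ = fromClosed (cycleThrough w sparse-w (suc k) 1+k<n)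
    where
    sparse = bookFree⇒sparse t v (w ∷ U) noBook unique nbrs
    sparse-w : count (adj G w) U ≤ t
    sparse-w = ≤-trans (count-∷ (adj G w) w U) (sparse w (here refl))
    sparse-U : ∀ x → x ∈ U → count (adj G x) U ≤ t
    sparse-U x x∈U = ≤-trans (count-∷ (adj G x) w U) (sparse x (there x∈U))
    1+k<n : suc k < length U
    1+k<n = subst (suc k <_) (sym len) (s≤s (s≤s k≤))
    open Dirac t U sparse-U (subst (suc (t + t) <_) (sym len) (n≤1+n _))
    fromClosed : (Σ (Fin N) λ a → Σ (List (Fin N)) λ as → a ∷ as ↭ U × Closed w (a ∷ take (suc k) as)) →
      Copy (cycleG k) (complement G)
    fromClosed (a , as , π , closed) = cycleCopy k w (a ∷ take (suc k) as) len′ unique′ closed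
      where
      1+k≤n : suc k ≤ length as
      1+k≤n = s≤s⁻¹ (subst (suc k <_) (sym (↭-length π)) 1+k<n)
      len′ : length (w ∷ a ∷ take (suc k) as) ≡ suc (suc (suc k))
      len′ = cong (suc ∘ suc) (trans (length-take (suc k) as) (m≤n⇒m⊓n≡m 1+k≤n))
      unique′ : Unique (w ∷ a ∷ take (suc k) as)
      unique′ = Unique-take⁺ (suc (suc (suc k))) (Unique-resp-↭ (prep w (↭-sym π)) unique)

  highDegree⇒complementCycle : ∀ t k (v : Fin N) → ¬ Contains G (book (suc t)) → 4 + (t + t) ≤ degree G v →
    k ≤ suc (t + t) → Copy (cycleG k) (complement G)
  highDegree⇒complementCycle t k v noBook deg≥ k≤ =
    fromNeighbours (filterᵇ (adj G v) (allFin N)) (Unique-filter⁺ _ (allFin⁺ N)) (all-filter _ (allFin N)) deg≥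
    where
    fromNeighbours : ∀ F → Unique F → All (λ y → T (adj G v y)) F → 4 + (t + t) ≤ length F →
      Copy (cycleG k) (complement G)
    fromNeighbours (w ∷ F) unique nbrs (s≤s len≥) =
      neighbourhoodCycle t k v w (take (3 + (t + t)) F) noBook
        (Unique-take⁺ (4 + (t + t)) unique) (All-take⁺ (4 + (t + t)) nbrs)
        (trans (length-take _ F) (m≤n⇒m⊓n≡m len≥)) k≤

2*[1+t]+2≡4+[t+t] : ∀ t → 2 * suc t + 2 ≡ 4 + (t + t)
2*[1+t]+2≡4+[t+t] = solve-∀

mainTheorem6 : (n m N : ℕ) → 1 ≤ n → (3≤m : 3 ≤ m) → m ≤ 2 * n + 2 →
    (G : Graph N) → 2 * n + 3 ≤ N →
    ¬ Contains G (book n) → ¬ Contains (complement G) (cycle m 3≤m) →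
    MaxDegree< G (2 * n + 2)
mainTheorem6 (suc t) (suc (suc (suc k))) N (s≤s z≤n) (s≤s (s≤s (s≤s z≤n))) m≤ G _ noBook noCycle v =
  ≰⇒> λ deg≥ → noCycle (highDegree⇒complementCycle G t k v noBook (subst (_≤ degree G v) (2*[1+t]+2≡4+[t+t] t) deg≥) k≤)
  where
  k≤ : k ≤ suc (t + t)
  k≤ = s≤s⁻¹ (s≤s⁻¹ (s≤s⁻¹ (subst (3 + k ≤_) (2*[1+t]+2≡4+[t+t] t) m≤)))
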